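{- Let $T\in\mathcal{M}_k^2\setminus\{\Lambda\}$, let $D$ be a nonempty test of $T$, let $T^*=I(P(T)\setminus D,T)$, and let $\Gamma$ be a deterministic decision tree for $T^*$. Then $\Gamma$ is a deterministic decision tree for $T$.
   Context: Fix an integer $k\ge 2$; $E_k=\{0,\ldots,k-1\}$, $E_2=\{0,1\}$, $P=\{f_i:i\in\{0,1,2,\ldots\}\}$ a set of attribute names. $\mathcal{M}_k^2$ is the set of rectangular tables filled with numbers from $E_k$, columns labeled with pairwise different attributes from $P$, rows pairwise different, each row labeled with a decision from $E_2$; the table without rows is denoted $\Lambda$. $P(T)$ is the set of column attributes. $\mathcal{M}_k^2\mathcal{C}$ is the set of tables in which all rows have the same decision. $T(f_{i_1},\delta_1)\cdots(f_{i_m},\delta_m)$ is the table of rows of $T$ having values $\delta_1,\ldots,\delta_m$ in the columns labeled $f_{i_1},\ldots,f_{i_m}$. For $C\subseteq P(T)$, $I(C,T)$ deletes the columns labeled by $C$ and, in each group of rows coinciding on the remaining columns, keeps only one row, one with the minimum decision. A test of $T$ is $D\subseteq P(T)$ such that any two rows of $T$ with different decisions differ in some column labeled by an attribute of $D$ (for $T\in\mathcal{M}_k^2\mathcal{C}$ every subset is a test). A $k$-decision tree: finite directed rooted tree with at least two nodes, root and its leaving edges unlabeled, terminal nodes labeled with decisions from $E_2$, other nodes labeled with attributes from $P$ whose leaving edges are labeled with numbers from $E_k$; $P(\Gamma)$ is the set of attributes labeling nodes. For a complete path $\tau=v_1,d_1,\ldots,v_m,d_m,v_{m+1}$ (root to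 terminal node), $T(\tau)=T$ if $m=1$, else $T(f_{i_2},\delta_2)\cdots(f_{i_m},\delta_m)$ where $v_j$ is labeled $f_{i_j}$ and $d_j$ is labeled $\delta_j$. For $T\ne\Lambda$, a deterministic decision tree for $T$: exactly one edge leaves the root, edges leaving any other nonterminal node have pairwise different labels, $P(\Gamma)\subseteq P(T)$, every row of $T$ lies in some $T(\tau)$, and for every complete path either $T(\tau)=\Lambda$ or all rows of $T(\tau)$ have the terminal node's decision. -}

module Defs where

open import Data.Nat using (ℕ; zero; suc)
open import Data.Fin using (Fin; zero; suc)
import Data.Fin.Properties as FinP
import Data.Nat.Properties as NatP
open import Data.List using (List; []; _∷_; map; zip; filter; foldr; deduplicate; length)
import Data.List.Properties as ListP
open import Data.List.Membership.Propositional using (_∈_)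
open import Data.List.Membership.DecPropositional NatP._≟_ using (_∈?_)
open import Data.List.Relation.Unary.All using (All)
open import Data.List.Relation.Unary.Any using (Any)
open import Data.List.Relation.Unary.Unique.Propositional using (Unique)
open import Data.Product using (_×_; _,_; proj₁; proj₂; ∃; Σ)
open import Data.Sum using (_⊎_)
open import Relation.Nullary using (¬_; ¬?)
open import Relation.Binary.PropositionalEquality using (_≡_; _≢_)

-- Tables of M_k^2 (raw data + validity predicate)
-- Attributes f_i are identified with their index i : ℕ.
-- A row is a list of values (aligned with the column list) with a decision in E_2 = Fin 2.

record Table (k : ℕ) : Set where
  constructor mkTable
  field
    cols : List ℕ
    rows : List (List (Fin k) × Fin 2)

open Table public

IsTable : ∀ {k} → Table k → Set
IsTable T =
  Unique (cols T)
  × All (λ rd → length (proj₁ rd) ≡ length (cols T)) (rows T)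
  × Unique (map proj₁ (rows T))

IsEmptyTable : ∀ {k} → Table k → Set
IsEmptyTable T = rows T ≡ []

HasValue : ∀ {k} → List ℕ → List (Fin k) → ℕ → Fin k → Set
HasValue cs r f δ = (f , δ) ∈ zip cs r

Satisfies : ∀ {k} → Table k → List (ℕ × Fin k) → List (Fin k) → Set
Satisfies T conds r = All (λ c → HasValue (cols T) r (proj₁ c) (proj₂ c)) conds

IsTest : ∀ {k} → Table k → List ℕ → Set
IsTest T D =
  All (_∈ cols T) D
  × (∀ r₁ d₁ r₂ d₂ → (r₁ , d₁) ∈ rows T → (r₂ , d₂) ∈ rows T → d₁ ≢ d₂ →
      ∃ λ f → ∃ λ δ₁ → ∃ λ δ₂ →
        f ∈ D × HasValue (cols T) r₁ f δ₁ × HasValue (cols T) r₂ f δ₂ × δ₁ ≢ δ₂)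

min₂ : Fin 2 → Fin 2 → Fin 2
min₂ zero _ = zero
min₂ (suc _) d = d

projRow : ∀ {k} → List ℕ → List ℕ → List (Fin k) → List (Fin k)
projRow C cs r = map proj₂ (filter (λ p → ¬? (proj₁ p ∈? C)) (zip cs r))

I : ∀ {k} → List ℕ → Table k → Table k
I {k} C T = mkTable newCols newRows
  where
  newCols : List ℕ
  newCols = filter (λ f → ¬? (f ∈? C)) (cols T)
  pr : List (Fin k) → List (Fin k)
  pr = projRow C (cols T)
  eqDec = ListP.≡-dec FinP._≟_
  minDec : List (Fin k) → Fin 2
  minDec r' = foldr min₂ (suc zero)
                (map proj₂ (filter (λ rd → eqDec (pr (proj₁ rd)) r') (rows T)))
  newRows : List (List (Fin k) × Fin 2)
  newRows = map (λ r' → r' , minDec r') (deduplicate eqDec (map (λ rd → pr (proj₁ rd)) (rows T)))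

Tstar : ∀ {k} → Table k → List ℕ → Table k
Tstar T D = I (filter (λ f → ¬? (f ∈? D)) (cols T)) T

data Node (k : ℕ) : Set where
  leaf : Fin 2 → Node k
  node : ℕ → List (Fin k × Node k) → Node k

-- the root is unlabelled; its (unlabelled) edges lead to these nodes
record DTree (k : ℕ) : Set where
  constructor tree
  field
    rootEdges : List (Node k)

open DTree public

data WFNode {k : ℕ} : Node k → Set where
  wf-leaf : ∀ {d} → WFNode (leaf d)
  wf-node : ∀ {f cs} → cs ≢ [] → All (λ e → WFNode (proj₂ e)) cs → WFNode (node f cs)

-- a k-decision tree (at least two nodes: root has a leaving edge)
IsKTree : ∀ {k} → DTree k → Set
IsKTree Γ = rootEdges Γ ≢ [] × All WFNode (rootEdges Γ)

data DetNode {k : ℕ} : Node k → Set where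
  det-leaf : ∀ {d} → DetNode (leaf d)
  det-node : ∀ {f cs} → Unique (map proj₁ cs) → All (λ e → DetNode (proj₂ e)) cs →
             DetNode (node f cs)

data AttrIn {k : ℕ} (f : ℕ) : Node k → Set where
  here  : ∀ {cs} → AttrIn f (node f cs)
  there : ∀ {g cs} → Any (λ e → AttrIn f (proj₂ e)) cs → AttrIn f (node g cs)

AttrInTree : ∀ {k} → ℕ → DTree k → Set
AttrInTree f Γ = Any (AttrIn f) (rootEdges Γ)

data PathFrom {k : ℕ} : Node k → List (ℕ × Fin k) → Fin 2 → Set where
  p-leaf : ∀ {d} → PathFrom (leaf d) [] d
  p-step : ∀ {f cs δ c conds d} → (δ , c) ∈ cs → PathFrom c conds d →
           PathFrom (node f cs) ((f , δ) ∷ conds) d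

CompletePath : ∀ {k} → DTree k → List (ℕ × Fin k) → Fin 2 → Set
CompletePath Γ conds d = ∃ λ v → v ∈ rootEdges Γ × PathFrom v conds d

IsDDT : ∀ {k} → Table k → DTree k → Set
IsDDT T Γ =
  ¬ IsEmptyTable T
  × IsKTree Γ
  × length (rootEdges Γ) ≡ 1
  × All DetNode (rootEdges Γ)
  × (∀ f → AttrInTree f Γ → f ∈ cols T)
  × (∀ r d → (r , d) ∈ rows T →
       ∃ λ conds → ∃ λ d' → CompletePath Γ conds d' × Satisfies T conds r)
  × (∀ conds d → CompletePath Γ conds d →
       (∀ r d' → (r , d') ∈ rows T → ¬ Satisfies T conds r)
       ⊎ (∀ r d' → (r , d') ∈ rows T → Satisfies T conds r → d' ≡ d))

{-# OPTIONS --safe #-}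
-- A row r of T and its reduction r* (r with the columns outside D deleted) agree on
-- every column of T* = I(P(T) \ D, T). Because D is a test, all rows of T with the
-- same reduction carry the same decision, so the minimum chosen by I is the decision
-- of r itself: (r*, d) is a row of T* whenever (r, d) is a row of T. Since Γ only asks
-- about columns of T*, a path of Γ selects r in T exactly when it selects r* in T*, and
-- both the covering and the consistency conditions carry over from T* to T.
module Submission where

open import Defs
open import Data.Nat using (ℕ; _≤_)
open import Data.List using (List; []; _∷_; map; zip; filter; foldr; length)
import Data.List.Properties as ListP
import Data.Nat.Properties as NatP
import Data.Fin.Properties as FinP
open import Data.Fin using (Fin; zero; suc)
open import Data.Bool using (true; false)
open import Data.List.Membership.Propositional using (_∈_; _∉_)
open import Data.List.Membership.Propositional.Properties
  using (∈-map⁺; ∈-map⁻; ∈-filter⁺; ∈-filter⁻; ∈-deduplicate⁺)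
open import Data.List.Membership.DecPropositional NatP._≟_ using (_∈?_)
open import Data.List.Relation.Unary.All as All using (All; []; _∷_)
open import Data.List.Relation.Unary.Any as Any using (here; there)
open import Data.List.Relation.Unary.AllPairs using (_∷_)
open import Data.List.Relation.Unary.Unique.Propositional using (Unique)
open import Data.Product using (_×_; _,_; proj₁; proj₂; ∃)
open import Data.Sum using (_⊎_; inj₁; inj₂)
open import Data.Empty using (⊥-elim)
open import Relation.Nullary using (¬_; ¬?; yes; no; does)
open import Relation.Unary using (Decidable)
open import Relation.Binary.PropositionalEquality
  using (_≡_; _≢_; refl; sym; cong; subst)

∈-zip⁻ˡ : ∀ {A B : Set} {xs : List A} {ys : List B} {a b} → (a , b) ∈ zip xs ys → a ∈ xs
∈-zip⁻ˡ {xs = _ ∷ _} {_ ∷ _} (here refl) = here refl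
∈-zip⁻ˡ {xs = _ ∷ _} {_ ∷ _} (there m)   = there (∈-zip⁻ˡ m)

zip-functional : ∀ {A B : Set} {xs : List A} {ys : List B} {a b b′} → Unique xs →
                 (a , b) ∈ zip xs ys → (a , b′) ∈ zip xs ys → b ≡ b′
zip-functional {xs = _ ∷ _} {_ ∷ _} _        (here refl) (here refl) = refl
zip-functional {xs = _ ∷ _} {_ ∷ _} (a∉ ∷ _) (here refl) (there m)   = ⊥-elim (All.lookup a∉ (∈-zip⁻ˡ m) refl)
zip-functional {xs = _ ∷ _} {_ ∷ _} (a∉ ∷ _) (there m)   (here refl) = ⊥-elim (All.lookup a∉ (∈-zip⁻ˡ m) refl)
zip-functional {xs = _ ∷ _} {_ ∷ _} (_ ∷ u)  (there m)   (there m′)  = zip-functional u m m′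

foldr-min₂-constant : ∀ (ds : List (Fin 2)) d → d ∈ ds → All (_≡ d) ds → foldr min₂ (suc zero) ds ≡ d
foldr-min₂-constant ds              (suc zero) _         all≡       = all-one ds all≡
  where
  all-one : ∀ ds → All (_≡ suc zero) ds → foldr min₂ (suc zero) ds ≡ suc zero
  all-one []       []          = refl
  all-one (_ ∷ ds) (refl ∷ as) = all-one ds as
foldr-min₂-constant (zero ∷ _)      zero       _         _          = refl
foldr-min₂-constant (suc zero ∷ ds) zero       (there m) (_ ∷ all≡) = foldr-min₂-constant ds zero m all≡

module Reduction {k : ℕ} (C : List ℕ) where

  Kept : List ℕ → List ℕ
  Kept = filter (λ f → ¬? (f ∈? C))

  reduce : List ℕ → List (Fin k) → List (Fin k)
  reduce = projRow C

  zip-reduce : ∀ cs (r : List (Fin k)) → length r ≡ length cs →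
               zip (Kept cs) (reduce cs r) ≡ filter (λ p → ¬? (proj₁ p ∈? C)) (zip cs r)
  zip-reduce []       []      _ = refl
  zip-reduce (f ∷ cs) (δ ∷ r) e with does (¬? (f ∈? C))
  ... | true  = cong ((f , δ) ∷_) (zip-reduce cs r (NatP.suc-injective e))
  ... | false = zip-reduce cs r (NatP.suc-injective e)

  HasValue-reduce⁻ : ∀ {cs r f δ} → length r ≡ length cs →
                     HasValue (Kept cs) (reduce cs r) f δ → HasValue cs r f δ
  HasValue-reduce⁻ {cs} {r} e h =
    proj₁ (∈-filter⁻ (λ p → ¬? (proj₁ p ∈? C)) (subst (_ ∈_) (zip-reduce cs r e) h))

  HasValue-reduce⁺ : ∀ {cs r f δ} → length r ≡ length cs → f ∉ C →
                     HasValue cs r f δ → HasValue (Kept cs) (reduce cs r) f δ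
  HasValue-reduce⁺ {cs} {r} e f∉C h =
    subst (_ ∈_) (sym (zip-reduce cs r e)) (∈-filter⁺ (λ p → ¬? (proj₁ p ∈? C)) h f∉C)

  module _ (T : Table k) where

    RowLengths : Set
    RowLengths = All (λ rd → length (proj₁ rd) ≡ length (cols T)) (rows T)

    reduceT : List (Fin k) → List (Fin k)
    reduceT = reduce (cols T)

    -- definitionally the minDec of the where block of I
    I-decision : List (Fin k) → Fin 2
    I-decision r′ = foldr min₂ (suc zero)
      (map proj₂ (filter (λ rd → ListP.≡-dec FinP._≟_ (reduceT (proj₁ rd)) r′) (rows T)))

    I-decision-constant : ∀ {r d} → (r , d) ∈ rows T →
      (∀ {r₂ d₂} → (r₂ , d₂) ∈ rows T → reduceT r₂ ≡ reduceT r → d₂ ≡ d) →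
      I-decision (reduceT r) ≡ d
    I-decision-constant {r} {d} rd∈ same = foldr-min₂-constant _ d
      (∈-map⁺ proj₂ (∈-filter⁺ sameReduct? rd∈ refl))
      (All.tabulate λ d₂∈ → decisionOf d₂∈)
      where
      sameReduct? : Decidable (λ (rd : List (Fin k) × Fin 2) → reduceT (proj₁ rd) ≡ reduceT r)
      sameReduct? rd = ListP.≡-dec FinP._≟_ (reduceT (proj₁ rd)) (reduceT r)
      decisionOf : ∀ {d₂} → d₂ ∈ map proj₂ (filter sameReduct? (rows T)) → d₂ ≡ d
      decisionOf d₂∈ with ∈-map⁻ proj₂ d₂∈
      ... | _ , rd₂∈ , refl with ∈-filter⁻ sameReduct? {xs = rows T} rd₂∈
      ... | rd₂∈T , e = same rd₂∈T e

    ∈-rows-I : ∀ {r d} → (r , d) ∈ rows T → (reduceT r , I-decision (reduceT r)) ∈ rows (I C T)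
    ∈-rows-I rd∈ = ∈-map⁺ _ (∈-deduplicate⁺ (ListP.≡-dec FinP._≟_) (∈-map⁺ (λ rd → reduceT (proj₁ rd)) rd∈))

    module _ (lengths : RowLengths) where

      Satisfies-I⁻ : ∀ {r d conds} → (r , d) ∈ rows T →
                     Satisfies (I C T) conds (reduceT r) → Satisfies T conds r
      Satisfies-I⁻ rd∈ = All.map (HasValue-reduce⁻ (All.lookup lengths rd∈))

      Satisfies-I⁺ : ∀ {r d conds} → (r , d) ∈ rows T → All (λ c → proj₁ c ∉ C) conds →
                     Satisfies T conds r → Satisfies (I C T) conds (reduceT r)
      Satisfies-I⁺ rd∈ []          []       = []
      Satisfies-I⁺ rd∈ (f∉C ∷ f∉s) (h ∷ hs) =
        HasValue-reduce⁺ (All.lookup lengths rd∈) f∉C h ∷ Satisfies-I⁺ rd∈ f∉s hs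

module _ {k : ℕ} (T : Table k) (D : List ℕ) where

  Outside : List ℕ
  Outside = filter (λ f → ¬? (f ∈? D)) (cols T)

  open Reduction {k} Outside

  -- two rows with the same reduction agree on D, so a test cannot separate them
  test⇒reduction-determines-decision : IsTable T → IsTest T D →
    ∀ {r d r₂ d₂} → (r , d) ∈ rows T → (r₂ , d₂) ∈ rows T →
    reduceT T r₂ ≡ reduceT T r → d₂ ≡ d
  test⇒reduction-determines-decision (unique , lengths , _) (_ , separates) {r} {d} {r₂} {d₂} rd∈ rd₂∈ e
    with d₂ FinP.≟ d
  ... | yes d₂≡d = d₂≡d
  ... | no d₂≢d with separates r₂ d₂ r d rd₂∈ rd∈ d₂≢d
  ... | f , δ₂ , δ , f∈D , h₂ , h , δ₂≢δ = ⊥-elim (δ₂≢δ (zip-functional unique h₂′ h))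
    where
    f∉Outside : f ∉ Outside
    f∉Outside f∈ = proj₂ (∈-filter⁻ (λ f → ¬? (f ∈? D)) {xs = cols T} f∈) f∈D
    h₂′ : HasValue (cols T) r f δ₂
    h₂′ = HasValue-reduce⁻ (All.lookup lengths rd∈)
            (subst (λ r′ → HasValue (Kept (cols T)) r′ f δ₂) e
              (HasValue-reduce⁺ (All.lookup lengths rd₂∈) f∉Outside h₂))

  ∈-rows-Tstar : IsTable T → IsTest T D →
                 ∀ {r d} → (r , d) ∈ rows T → (reduceT T r , d) ∈ rows (Tstar T D)
  ∈-rows-Tstar isTable test rd∈ =
    subst (λ d → (_ , d) ∈ rows (Tstar T D))
      (I-decision-constant T rd∈ (test⇒reduction-determines-decision isTable test rd∈))
      (∈-rows-I T rd∈)

PathFrom⇒AttrIn : ∀ {k} {v : Node k} {conds d} → PathFrom v conds d → All (λ c → AttrIn (proj₁ c) v) conds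
PathFrom⇒AttrIn p-leaf         = []
PathFrom⇒AttrIn (p-step e∈ p) = here ∷ All.map (λ a → there (Any.map (λ { refl → a }) e∈)) (PathFrom⇒AttrIn p)

CompletePath⇒AttrInTree : ∀ {k} {Γ : DTree k} {conds d} → CompletePath Γ conds d →
                          All (λ c → AttrInTree (proj₁ c) Γ) conds
CompletePath⇒AttrInTree (_ , v∈ , p) = All.map (λ a → Any.map (λ { refl → a }) v∈) (PathFrom⇒AttrIn p)

lemma2 : (k : ℕ) → 2 ≤ k → (T : Table k) → IsTable T → ¬ IsEmptyTable T →
         (D : List ℕ) → D ≢ [] → IsTest T D →
         (Γ : DTree k) → IsDDT (Tstar T D) Γ → IsDDT T Γ
lemma2 k _ T isTable@(_ , lengths , _) T≢Λ D _ test Γ (_ , kTree , oneRootEdge , det , attrs , covers , consistent) =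
  T≢Λ , kTree , oneRootEdge , det , attrs′ , covers′ , consistent′
  where
  open Reduction {k} (Outside T D)
  row* : ∀ {r d} → (r , d) ∈ rows T → (reduceT T r , d) ∈ rows (Tstar T D)
  row* = ∈-rows-Tstar T D isTable test

  attrs′ : ∀ f → AttrInTree f Γ → f ∈ cols T
  attrs′ f a = proj₁ (∈-filter⁻ (λ f → ¬? (f ∈? Outside T D)) {xs = cols T} (attrs f a))

  outsideAttrs : ∀ {conds d} → CompletePath Γ conds d → All (λ c → proj₁ c ∉ Outside T D) conds
  outsideAttrs τ = All.map (λ a → proj₂ (∈-filter⁻ (λ f → ¬? (f ∈? Outside T D)) {xs = cols T} (attrs _ a)))
                           (CompletePath⇒AttrInTree τ)

  covers′ : ∀ r d → (r , d) ∈ rows T → ∃ λ conds → ∃ λ d′ → CompletePath Γ conds d′ × Satisfies T conds r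
  covers′ r d rd∈ with covers (reduceT T r) d (row* rd∈)
  ... | conds , d′ , τ , sat = conds , d′ , τ , Satisfies-I⁻ T lengths rd∈ sat

  consistent′ : ∀ conds d → CompletePath Γ conds d →
                (∀ r d′ → (r , d′) ∈ rows T → ¬ Satisfies T conds r)
                ⊎ (∀ r d′ → (r , d′) ∈ rows T → Satisfies T conds r → d′ ≡ d)
  consistent′ conds d τ with consistent conds d τ
  ... | inj₁ empty   = inj₁ λ r d′ rd∈ sat → empty (reduceT T r) d′ (row* rd∈) (Satisfies-I⁺ T lengths rd∈ (outsideAttrs τ) sat)
  ... | inj₂ uniform = inj₂ λ r d′ rd∈ sat → uniform (reduceT T r) d′ (row* rd∈) (Satisfies-I⁺ T lengths rd∈ (outsideAttrs τ) sat)
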